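{- Let $f_i(x)=a_ix+b_i$ ($i=1,2,3,4$) be linear functions with $a_i\ge0$. If $a_1,a_3\ge1$, $a_2,a_4<1$ and $\gamma(f_1)\ge\gamma(f_2)\ge\gamma(f_3)\ge\gamma(f_4)$, then for all $x\in\mathbb{R}$, $$f_4\circ f_3\circ f_2\circ f_1(x)\le\max\{f_4\circ f_1\circ f_3\circ f_2(x),\ f_3\circ f_2\circ f_4\circ f_1(x)\}.$$
   Context: For a linear function $f(x)=ax+b$ define $\gamma(f)=b/(1-a)$ if $a\ne1$, $\gamma(f)=+\infty$ if $a=1$ and $b<0$, $\gamma(f)=-\infty$ if $a=1$ and $b\ge0$. -}

module Defs where

open import Level using (0ℓ)
open import Data.Product using (∃; _×_)
open import Relation.Binary.PropositionalEquality using (_≡_)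
open import Relation.Binary.Structures using (IsTotalOrder)
open import Algebra.Structures using (IsCommutativeRing)
open import Relation.Nullary using (¬_)

-- An (abstract) ordered field.  The real numbers ℝ are an instance; the
-- standard library has no reals, so the statement is proved for every
-- ordered field (which includes ℝ).
record OrderedField : Set₁ where
  infixl 6 _+_ _-_
  infixl 7 _*_
  infix 4 _≤_ _<_
  field
    Carrier : Set
    _+_ _*_ : Carrier → Carrier → Carrier
    -_      : Carrier → Carrier
    0# 1#   : Carrier
    _≤_     : Carrier → Carrier → Set
    isCommutativeRing : IsCommutativeRing _≡_ _+_ _*_ -_ 0# 1#
    isTotalOrder      : IsTotalOrder _≡_ _≤_
    0≢1     : ¬ (0# ≡ 1#)
    inverse : ∀ x → ¬ (x ≡ 0#) → ∃ λ y → x * y ≡ 1#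
    +-mono-≤ : ∀ {x y} z → x ≤ y → x + z ≤ y + z
    *-nonneg : ∀ {x y} → 0# ≤ x → 0# ≤ y → 0# ≤ x * y

  _-_ : Carrier → Carrier → Carrier
  x - y = x + (- y)

  _<_ : Carrier → Carrier → Set
  x < y = x ≤ y × ¬ (x ≡ y)

module _ (F : OrderedField) where
  open OrderedField F

  data Ext : Set where
    -∞  : Ext
    fin : Carrier → Ext
    +∞  : Ext

  data _≤E_ : Ext → Ext → Set where
    -∞≤     : ∀ {e} → -∞ ≤E e
    ≤+∞     : ∀ {e} → e ≤E +∞
    fin≤fin : ∀ {x y} → x ≤ y → fin x ≤E fin y

  lin : Carrier → Carrier → Carrier → Carrier
  lin a b x = a * x + b

  -- IsGamma a b e  ⟺  γ(f) = e  for f(x) = a x + b, i.e.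
  --   γ(f) = b/(1-a) if a ≠ 1  (g = b/(1-a) written as g·(1-a) = b),
  --   γ(f) = +∞ if a = 1 and b < 0,  γ(f) = −∞ if a = 1 and b ≥ 0.
  data IsGamma (a b : Carrier) : Ext → Set where
    γ-fin   : ∀ {g} → ¬ (a ≡ 1#) → g * (1# - a) ≡ b → IsGamma a b (fin g)
    γ-plus  : a ≡ 1# → b < 0# → IsGamma a b +∞
    γ-minus : a ≡ 1# → 0# ≤ b → IsGamma a b -∞

module Submission where

-- Write fᵢ(x) = aᵢx + bᵢ and h = f₃ ∘ f₂ (slope s = a₂a₃).
-- For linear maps f, g with slopes a, c and any reference point p,
--     f(g(x)) − g(f(x)) = (1 − c)(f(p) − p) + (1 − a)(p − g(p)),
-- so whether f ∘ g dominates g ∘ f is decided by the slopes and by the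
-- directions in which f and g move a single point p.  Take p = γ(f₂),
-- which is finite because a₂ < 1.  The ordering of the γ's says exactly
-- that f₁ and f₄ move p down while f₂ and f₃ move p up, hence so does h.
--   * If s ≤ 1 then h and f₄ are both non-expanding, and f₄ ∘ h ≤ h ∘ f₄;
--     evaluated at f₁(x) this is the second alternative.
--   * If s ≥ 1 then h and f₁ are both non-contracting, and h ∘ f₁ ≤ f₁ ∘ h;
--     applying the monotone map f₄ gives the first alternative.

open import Defs
open import Algebra.Bundles using (CommutativeRing; RawRing)
open import Data.Product.Base using (∃; _×_; _,_; proj₁; proj₂)
open import Data.Sum.Base using (_⊎_; inj₁; inj₂; [_,_]′)
open import Function.Base using (_∘_)
open import Relation.Binary.PropositionalEquality as ≡ using (_≡_)

-- The ring solver of the library, for an arbitrary commutative ring R, with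
-- integer coefficients represented as formal differences (m , n) ↦ m − n.
-- Coefficients are kept reduced (one component zero), so that the normal
-- forms of equal polynomials coincide syntactically.
module IntegerCoefficientSolver {c ℓ} (R : CommutativeRing c ℓ) where
  open import Data.Nat.Base as ℕ using (ℕ; zero; suc; _∸_)
  open import Data.Nat.Properties using (_≟_)
  import Data.Product.Properties as Product
  open import Data.Maybe.Base using (map)
  open import Relation.Binary.Consequences using (dec⇒weaklyDec)
  open import Algebra.Solver.Ring.AlmostCommutativeRing
    using (fromCommutativeRing; _-Raw-AlmostCommutative⟶_)
  open CommutativeRing R
  open import Algebra.Properties.Ring ring
  open import Algebra.Properties.CommutativeSemigroup +-commutativeSemigroup
    using (interchange)
  open import Algebra.Properties.Semiring.Mult.TCOptimised semiring
    using (1+×; ×-homo-+; ×1-homo-*) renaming (_×_ to _×′_)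
  open import Relation.Binary.Reasoning.Setoid setoid

  sub-interchange : ∀ x y z w → (x + y) - (z + w) ≈ (x - z) + (y - w)
  sub-interchange x y z w = begin
    (x + y) - (z + w)      ≈⟨ +-congˡ (sym (-‿+-comm z w)) ⟩
    (x + y) + (- z + - w)  ≈⟨ interchange x y (- z) (- w) ⟩
    (x - z) + (y - w)      ∎

  sub-cancelˡ : ∀ x y z → (x + y) - (x + z) ≈ y - z
  sub-cancelˡ x y z = begin
    (x + y) - (x + z)  ≈⟨ sub-interchange x y x z ⟩
    (x - x) + (y - z)  ≈⟨ +-congʳ (-‿inverseʳ x) ⟩
    0# + (y - z)       ≈⟨ +-identityˡ (y - z) ⟩
    y - z              ∎

  difference-product : ∀ p q r s → (p - q) * (r - s) ≈ (p * r + q * s) - (p * s + q * r)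
  difference-product p q r s = begin
    (p - q) * (r - s)                  ≈⟨ [y-z]x≈yx-zx (r - s) p q ⟩
    p * (r - s) - q * (r - s)          ≈⟨ +-cong (x[y-z]≈xy-xz p r s) (-‿cong (x[y-z]≈xy-xz q r s)) ⟩
    (p * r - p * s) - (q * r - q * s)  ≈⟨ +-congˡ (⁻¹-anti-homo‿- (q * r) (q * s)) ⟩
    (p * r - p * s) + (q * s - q * r)  ≈⟨ sub-interchange (p * r) (q * s) (p * s) (q * r) ⟨
    (p * r + q * s) - (p * s + q * r)  ∎

  reduce : ℕ × ℕ → ℕ × ℕ
  reduce (m , n) = (m ∸ n , n ∸ m)

  differences : RawRing _ _
  differences = record
    { Carrier = ℕ × ℕ
    ; _≈_     = _≡_
    ; _+_     = λ { (m , n) (p , q) → reduce (m ℕ.+ p , n ℕ.+ q) }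
    ; _*_     = λ { (m , n) (p , q) → reduce (m ℕ.* p ℕ.+ n ℕ.* q , m ℕ.* q ℕ.+ n ℕ.* p) }
    ; -_      = λ { (m , n) → (n , m) }
    ; 0#      = (0 , 0)
    ; 1#      = (1 , 0)
    }

  -- Interpretation of a difference in R, chosen so that (0 , 0) and (1 , 0)
  -- denote 0# and 1# definitionally.
  ⟦_⟧ᶜ : ℕ × ℕ → Carrier
  ⟦ m     , zero  ⟧ᶜ = m ×′ 1#
  ⟦ zero  , suc n ⟧ᶜ = - (suc n ×′ 1#)
  ⟦ suc m , suc n ⟧ᶜ = ⟦ m , n ⟧ᶜ

  ⟦⟧ᶜ-reduce : ∀ m n → ⟦ reduce (m , n) ⟧ᶜ ≡ ⟦ m , n ⟧ᶜ
  ⟦⟧ᶜ-reduce zero    zero    = ≡.refl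
  ⟦⟧ᶜ-reduce (suc m) zero    = ≡.refl
  ⟦⟧ᶜ-reduce zero    (suc n) = ≡.refl
  ⟦⟧ᶜ-reduce (suc m) (suc n) = ⟦⟧ᶜ-reduce m n

  ⟦⟧ᶜ-difference : ∀ m n → ⟦ m , n ⟧ᶜ ≈ m ×′ 1# - n ×′ 1#
  ⟦⟧ᶜ-difference m       zero    = sym (trans (+-congˡ -0#≈0#) (+-identityʳ (m ×′ 1#)))
  ⟦⟧ᶜ-difference zero    (suc n) = sym (+-identityˡ (- (suc n ×′ 1#)))
  ⟦⟧ᶜ-difference (suc m) (suc n) = begin
    ⟦ m , n ⟧ᶜ                       ≈⟨ ⟦⟧ᶜ-difference m n ⟩
    m ×′ 1# - n ×′ 1#                ≈⟨ sub-cancelˡ 1# (m ×′ 1#) (n ×′ 1#) ⟨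
    (1# + m ×′ 1#) - (1# + n ×′ 1#)  ≈⟨ +-cong (1+× m 1#) (-‿cong (1+× n 1#)) ⟨
    suc m ×′ 1# - suc n ×′ 1#        ∎

  ⟦⟧ᶜ-+ : ∀ m n p q → ⟦ reduce (m ℕ.+ p , n ℕ.+ q) ⟧ᶜ ≈ ⟦ m , n ⟧ᶜ + ⟦ p , q ⟧ᶜ
  ⟦⟧ᶜ-+ m n p q = begin
    ⟦ reduce (m ℕ.+ p , n ℕ.+ q) ⟧ᶜ            ≡⟨ ⟦⟧ᶜ-reduce (m ℕ.+ p) (n ℕ.+ q) ⟩
    ⟦ m ℕ.+ p , n ℕ.+ q ⟧ᶜ                     ≈⟨ ⟦⟧ᶜ-difference (m ℕ.+ p) (n ℕ.+ q) ⟩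
    (m ℕ.+ p) ×′ 1# - (n ℕ.+ q) ×′ 1#          ≈⟨ +-cong (×-homo-+ 1# m p) (-‿cong (×-homo-+ 1# n q)) ⟩
    (m ×′ 1# + p ×′ 1#) - (n ×′ 1# + q ×′ 1#)  ≈⟨ sub-interchange (m ×′ 1#) (p ×′ 1#) (n ×′ 1#) (q ×′ 1#) ⟩
    (m ×′ 1# - n ×′ 1#) + (p ×′ 1# - q ×′ 1#)  ≈⟨ +-cong (⟦⟧ᶜ-difference m n) (⟦⟧ᶜ-difference p q) ⟨
    ⟦ m , n ⟧ᶜ + ⟦ p , q ⟧ᶜ                    ∎

  ⟦⟧ᶜ-* : ∀ m n p q →
    ⟦ reduce (m ℕ.* p ℕ.+ n ℕ.* q , m ℕ.* q ℕ.+ n ℕ.* p) ⟧ᶜ ≈ ⟦ m , n ⟧ᶜ * ⟦ p , q ⟧ᶜ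
  ⟦⟧ᶜ-* m n p q = begin
    ⟦ reduce (mp+nq , mq+np) ⟧ᶜ          ≡⟨ ⟦⟧ᶜ-reduce mp+nq mq+np ⟩
    ⟦ mp+nq , mq+np ⟧ᶜ                   ≈⟨ ⟦⟧ᶜ-difference mp+nq mq+np ⟩
    mp+nq ×′ 1# - mq+np ×′ 1#            ≈⟨ +-cong (sum-of-products m p n q) (-‿cong (sum-of-products m q n p)) ⟩
    (M * P + N * Q) - (M * Q + N * P)    ≈⟨ difference-product M N P Q ⟨
    (M - N) * (P - Q)                    ≈⟨ *-cong (⟦⟧ᶜ-difference m n) (⟦⟧ᶜ-difference p q) ⟨
    ⟦ m , n ⟧ᶜ * ⟦ p , q ⟧ᶜ              ∎
    where
    mp+nq = m ℕ.* p ℕ.+ n ℕ.* q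
    mq+np = m ℕ.* q ℕ.+ n ℕ.* p
    M = m ×′ 1#
    N = n ×′ 1#
    P = p ×′ 1#
    Q = q ×′ 1#
    sum-of-products : ∀ i j k l → (i ℕ.* j ℕ.+ k ℕ.* l) ×′ 1# ≈ (i ×′ 1#) * (j ×′ 1#) + (k ×′ 1#) * (l ×′ 1#)
    sum-of-products i j k l = trans (×-homo-+ 1# (i ℕ.* j) (k ℕ.* l)) (+-cong (×1-homo-* i j) (×1-homo-* k l))

  ⟦⟧ᶜ-neg : ∀ m n → ⟦ n , m ⟧ᶜ ≈ - ⟦ m , n ⟧ᶜ
  ⟦⟧ᶜ-neg m n = begin
    ⟦ n , m ⟧ᶜ             ≈⟨ ⟦⟧ᶜ-difference n m ⟩
    n ×′ 1# - m ×′ 1#      ≈⟨ ⁻¹-anti-homo‿- (m ×′ 1#) (n ×′ 1#) ⟨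
    - (m ×′ 1# - n ×′ 1#)  ≈⟨ -‿cong (⟦⟧ᶜ-difference m n) ⟨
    - ⟦ m , n ⟧ᶜ           ∎

  embedding : differences -Raw-AlmostCommutative⟶ fromCommutativeRing R
  embedding = record
    { ⟦_⟧    = ⟦_⟧ᶜ
    ; +-homo = λ { (m , n) (p , q) → ⟦⟧ᶜ-+ m n p q }
    ; *-homo = λ { (m , n) (p , q) → ⟦⟧ᶜ-* m n p q }
    ; -‿homo = λ { (m , n) → ⟦⟧ᶜ-neg m n }
    ; 0-homo = refl
    ; 1-homo = refl
    }

  -- Equality of reduced differences is decidable, which lets the solver
  -- recognise vanishing coefficients.
  open import Algebra.Solver.Ring differences (fromCommutativeRing R) embedding
    (λ i j → map (λ i≡j → reflexive (≡.cong ⟦_⟧ᶜ i≡j)) (dec⇒weaklyDec (Product.≡-dec _≟_ _≟_) i j))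
    public using (Polynomial; solve; _:=_; _:+_; _:*_; _:-_; con)

  :0 :1 : ∀ {n} → Polynomial n
  :0 = con (0 , 0)
  :1 = con (1 , 0)

module LinearMaps (F : OrderedField) where
  open OrderedField F
  open import Level using (0ℓ)
  open import Data.Empty using (⊥-elim)
  open import Relation.Binary.Bundles using (Poset)
  open import Relation.Binary.Structures using (IsTotalOrder)
  open IsTotalOrder isTotalOrder using (total)
    renaming (refl to ≤-refl; trans to ≤-trans; isPartialOrder to ≤-isPartialOrder)

  field-ring : CommutativeRing 0ℓ 0ℓ
  field-ring = record { isCommutativeRing = isCommutativeRing }

  open IntegerCoefficientSolver field-ring using (solve; _:=_; _:+_; _:*_; _:-_; :0; :1)

  ≤-poset : Poset 0ℓ 0ℓ 0ℓ
  ≤-poset = record { isPartialOrder = ≤-isPartialOrder }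

  open import Relation.Binary.Reasoning.PartialOrder ≤-poset

  infix 4 _≤ₑ_
  _≤ₑ_ : Ext F → Ext F → Set
  _≤ₑ_ = _≤E_ F

  ≤ₑ-trans : ∀ {d e f} → d ≤ₑ e → e ≤ₑ f → d ≤ₑ f
  ≤ₑ-trans -∞≤             _               = -∞≤
  ≤ₑ-trans _               ≤+∞             = ≤+∞
  ≤ₑ-trans (fin≤fin x≤y)   (fin≤fin y≤z)   = fin≤fin (≤-trans x≤y y≤z)

  ≤-by-increment : ∀ {x y} d → 0# ≤ d → y ≡ x + d → x ≤ y
  ≤-by-increment {x} {y} d 0≤d y≡x+d = begin
    x         ≡⟨ solve 1 (λ x → x := :0 :+ x) ≡.refl x ⟩
    0# + x    ≤⟨ +-mono-≤ x 0≤d ⟩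
    d + x     ≡⟨ solve 2 (λ d x → d :+ x := x :+ d) ≡.refl d x ⟩
    x + d     ≡⟨ ≡.sym y≡x+d ⟩
    y         ∎

  nonneg-difference : ∀ {x y} → x ≤ y → 0# ≤ y - x
  nonneg-difference {x} {y} x≤y = begin
    0#        ≡⟨ solve 1 (λ x → :0 := x :- x) ≡.refl x ⟩
    x - x     ≤⟨ +-mono-≤ (- x) x≤y ⟩
    y - x     ∎

  nonneg-+ : ∀ {x y} → 0# ≤ x → 0# ≤ y → 0# ≤ x + y
  nonneg-+ {y = y} 0≤x 0≤y = ≤-trans 0≤x (≤-by-increment y 0≤y ≡.refl)

  composition : ∀ a₂ b₂ a₃ b₃ x → lin F a₃ b₃ (lin F a₂ b₂ x) ≡ lin F (a₂ * a₃) (a₃ * b₂ + b₃) x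
  composition = solve 5 (λ a₂ b₂ a₃ b₃ x → a₃ :* (a₂ :* x :+ b₂) :+ b₃ := (a₂ :* a₃) :* x :+ (a₃ :* b₂ :+ b₃)) ≡.refl

  lin-mono : ∀ {a b x y} → 0# ≤ a → x ≤ y → lin F a b x ≤ lin F a b y
  lin-mono {a} {b} {x} {y} 0≤a x≤y =
    ≤-by-increment (a * (y - x)) (*-nonneg 0≤a (nonneg-difference x≤y)) (increment a b x y)
    where
    increment : ∀ a b x y → lin F a b y ≡ lin F a b x + a * (y - x)
    increment = solve 4 (λ a b x y → a :* y :+ b := (a :* x :+ b) :+ a :* (y :- x)) ≡.refl

  commutator : ∀ a b c d p x →
    lin F a b (lin F c d x) ≡ lin F c d (lin F a b x) + ((1# - c) * (lin F a b p - p) + (1# - a) * (p - lin F c d p))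
  commutator = solve 6 (λ a b c d p x →
    a :* (c :* x :+ d) :+ b
      := (c :* (a :* x :+ b) :+ d) :+ ((:1 :- c) :* ((a :* p :+ b) :- p) :+ (:1 :- a) :* (p :- (c :* p :+ d))))
    ≡.refl

  non-expanding-commute : ∀ {a b c d} p x → a ≤ 1# → c ≤ 1# → p ≤ lin F a b p → lin F c d p ≤ p →
    lin F c d (lin F a b x) ≤ lin F a b (lin F c d x)
  non-expanding-commute {a} {b} {c} {d} p x a≤1 c≤1 p≤fp gp≤p =
    ≤-by-increment _
      (nonneg-+ (*-nonneg (nonneg-difference c≤1) (nonneg-difference p≤fp))
                (*-nonneg (nonneg-difference a≤1) (nonneg-difference gp≤p)))
      (commutator a b c d p x)

  non-contracting-commute : ∀ {a b c d} p x → 1# ≤ a → 1# ≤ c → lin F a b p ≤ p → p ≤ lin F c d p →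
    lin F c d (lin F a b x) ≤ lin F a b (lin F c d x)
  non-contracting-commute {a} {b} {c} {d} p x 1≤a 1≤c fp≤p p≤gp =
    ≤-by-increment _
      (nonneg-+ (*-nonneg (nonneg-difference 1≤c) (nonneg-difference fp≤p))
                (*-nonneg (nonneg-difference 1≤a) (nonneg-difference p≤gp)))
      (≡.trans (commutator a b c d p x) (≡.cong (lin F c d (lin F a b x) +_) (flip-signs a c (lin F a b p) (lin F c d p) p)))
    where
    flip-signs : ∀ a c u v p → (1# - c) * (u - p) + (1# - a) * (p - v) ≡ (c - 1#) * (p - u) + (a - 1#) * (v - p)
    flip-signs = solve 5 (λ a c u v p →
      (:1 :- c) :* (u :- p) :+ (:1 :- a) :* (p :- v) := (c :- :1) :* (p :- u) :+ (a :- :1) :* (v :- p)) ≡.refl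

  four-map-inequality : ∀ {a₁ b₁ a₂ b₂ a₃ b₃ a₄ b₄} p → 0# ≤ a₃ → 0# ≤ a₄ → 1# ≤ a₁ → a₄ ≤ 1# →
    lin F a₁ b₁ p ≤ p → p ≤ lin F a₂ b₂ p → p ≤ lin F a₃ b₃ p → lin F a₄ b₄ p ≤ p → ∀ x →
      (lin F a₄ b₄ (lin F a₃ b₃ (lin F a₂ b₂ (lin F a₁ b₁ x)))
        ≤ lin F a₄ b₄ (lin F a₁ b₁ (lin F a₃ b₃ (lin F a₂ b₂ x))))
      ⊎
      (lin F a₄ b₄ (lin F a₃ b₃ (lin F a₂ b₂ (lin F a₁ b₁ x)))
        ≤ lin F a₃ b₃ (lin F a₂ b₂ (lin F a₄ b₄ (lin F a₁ b₁ x))))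
  four-map-inequality {a₁} {b₁} {a₂} {b₂} {a₃} {b₃} {a₄} {b₄} p 0≤a₃ 0≤a₄ 1≤a₁ a₄≤1 f₁p≤p p≤f₂p p≤f₃p f₄p≤p x =
    [ inj₂ ∘ second-alternative , inj₁ ∘ first-alternative ]′ (total (a₂ * a₃) 1#)
    where
    f₁ f₂ f₃ f₄ h : Carrier → Carrier
    f₁ = lin F a₁ b₁
    f₂ = lin F a₂ b₂
    f₃ = lin F a₃ b₃
    f₄ = lin F a₄ b₄
    h  = lin F (a₂ * a₃) (a₃ * b₂ + b₃)

    p≤hp : p ≤ h p
    p≤hp = begin
      p          ≤⟨ p≤f₃p ⟩
      f₃ p       ≤⟨ lin-mono 0≤a₃ p≤f₂p ⟩
      f₃ (f₂ p)  ≡⟨ composition a₂ b₂ a₃ b₃ p ⟩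
      h p        ∎

    second-alternative : a₂ * a₃ ≤ 1# → f₄ (f₃ (f₂ (f₁ x))) ≤ f₃ (f₂ (f₄ (f₁ x)))
    second-alternative s≤1 = begin
      f₄ (f₃ (f₂ (f₁ x)))  ≡⟨ ≡.cong f₄ (composition a₂ b₂ a₃ b₃ (f₁ x)) ⟩
      f₄ (h (f₁ x))        ≤⟨ non-expanding-commute p (f₁ x) s≤1 a₄≤1 p≤hp f₄p≤p ⟩
      h (f₄ (f₁ x))        ≡⟨ composition a₂ b₂ a₃ b₃ (f₄ (f₁ x)) ⟨
      f₃ (f₂ (f₄ (f₁ x)))  ∎

    first-alternative : 1# ≤ a₂ * a₃ → f₄ (f₃ (f₂ (f₁ x))) ≤ f₄ (f₁ (f₃ (f₂ x)))
    first-alternative 1≤s = lin-mono 0≤a₄ (begin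
      f₃ (f₂ (f₁ x))  ≡⟨ composition a₂ b₂ a₃ b₃ (f₁ x) ⟩
      h (f₁ x)        ≤⟨ non-contracting-commute p x 1≤a₁ 1≤s f₁p≤p p≤hp ⟩
      f₁ (h x)        ≡⟨ ≡.cong f₁ (composition a₂ b₂ a₃ b₃ x) ⟨
      f₁ (f₃ (f₂ x))  ∎)

  contracting-γ-finite : ∀ {a b γ} → a < 1# → IsGamma F a b γ → ∃ λ p → fin p ≤ₑ γ × γ ≤ₑ fin p
  contracting-γ-finite _   (γ-fin {g} _ _)  = g , fin≤fin ≤-refl , fin≤fin ≤-refl
  contracting-γ-finite a<1 (γ-plus a≡1 _)  = ⊥-elim (proj₂ a<1 a≡1)
  contracting-γ-finite a<1 (γ-minus a≡1 _) = ⊥-elim (proj₂ a<1 a≡1)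

  contracting-pushes-up : ∀ {a b γ p} → a < 1# → IsGamma F a b γ → fin p ≤ₑ γ → p ≤ lin F a b p
  contracting-pushes-up {a} {p = p} a<1 (γ-fin {g} _ ≡.refl) (fin≤fin p≤g) =
    ≤-by-increment _ (*-nonneg (nonneg-difference (proj₁ a<1)) (nonneg-difference p≤g))
      (solve 3 (λ a g p → a :* p :+ g :* (:1 :- a) := p :+ (:1 :- a) :* (g :- p)) ≡.refl a g p)
  contracting-pushes-up a<1 (γ-plus a≡1 _)  _ = ⊥-elim (proj₂ a<1 a≡1)
  contracting-pushes-up a<1 (γ-minus a≡1 _) _ = ⊥-elim (proj₂ a<1 a≡1)

  contracting-pulls-down : ∀ {a b γ p} → a < 1# → IsGamma F a b γ → γ ≤ₑ fin p → lin F a b p ≤ p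
  contracting-pulls-down {a} {p = p} a<1 (γ-fin {g} _ ≡.refl) (fin≤fin g≤p) =
    ≤-by-increment _ (*-nonneg (nonneg-difference (proj₁ a<1)) (nonneg-difference g≤p))
      (solve 3 (λ a g p → p := (a :* p :+ g :* (:1 :- a)) :+ (:1 :- a) :* (p :- g)) ≡.refl a g p)
  contracting-pulls-down a<1 (γ-plus a≡1 _)  _ = ⊥-elim (proj₂ a<1 a≡1)
  contracting-pulls-down a<1 (γ-minus a≡1 _) _ = ⊥-elim (proj₂ a<1 a≡1)

  -- A map of slope a ≥ 1 moves every point away from γ (a translation
  -- x ↦ x + b, with γ = ∓∞, moves every point in the direction of b).
  expanding-pulls-down : ∀ {a b γ p} → 1# ≤ a → IsGamma F a b γ → fin p ≤ₑ γ → lin F a b p ≤ p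
  expanding-pulls-down {a} {p = p} 1≤a (γ-fin {g} _ ≡.refl) (fin≤fin p≤g) =
    ≤-by-increment _ (*-nonneg (nonneg-difference 1≤a) (nonneg-difference p≤g))
      (solve 3 (λ a g p → p := (a :* p :+ g :* (:1 :- a)) :+ (a :- :1) :* (g :- p)) ≡.refl a g p)
  expanding-pulls-down {b = b} {p = p} _ (γ-plus ≡.refl b<0) ≤+∞ =
    ≤-by-increment _ (nonneg-difference (proj₁ b<0))
      (solve 2 (λ b p → p := (:1 :* p :+ b) :+ (:0 :- b)) ≡.refl b p)

  expanding-pushes-up : ∀ {a b γ p} → 1# ≤ a → IsGamma F a b γ → γ ≤ₑ fin p → p ≤ lin F a b p
  expanding-pushes-up {a} {p = p} 1≤a (γ-fin {g} _ ≡.refl) (fin≤fin g≤p) =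
    ≤-by-increment _ (*-nonneg (nonneg-difference 1≤a) (nonneg-difference g≤p))
      (solve 3 (λ a g p → a :* p :+ g :* (:1 :- a) := p :+ (a :- :1) :* (p :- g)) ≡.refl a g p)
  expanding-pushes-up {b = b} {p = p} _ (γ-minus ≡.refl 0≤b) -∞≤ =
    ≤-by-increment b 0≤b (solve 2 (λ b p → :1 :* p :+ b := p :+ b) ≡.refl b p)

lemma12 : (F : OrderedField) → let open OrderedField F in
    ∀ (a₁ b₁ a₂ b₂ a₃ b₃ a₄ b₄ : Carrier) (γ₁ γ₂ γ₃ γ₄ : Ext F) →
    0# ≤ a₁ → 0# ≤ a₂ → 0# ≤ a₃ → 0# ≤ a₄ →
    1# ≤ a₁ → 1# ≤ a₃ → a₂ < 1# → a₄ < 1# →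
    IsGamma F a₁ b₁ γ₁ → IsGamma F a₂ b₂ γ₂ →
    IsGamma F a₃ b₃ γ₃ → IsGamma F a₄ b₄ γ₄ →
    _≤E_ F γ₂ γ₁ → _≤E_ F γ₃ γ₂ → _≤E_ F γ₄ γ₃ →
    ∀ (x : Carrier) →
      (lin F a₄ b₄ (lin F a₃ b₃ (lin F a₂ b₂ (lin F a₁ b₁ x)))
        ≤ lin F a₄ b₄ (lin F a₁ b₁ (lin F a₃ b₃ (lin F a₂ b₂ x))))
      ⊎
      (lin F a₄ b₄ (lin F a₃ b₃ (lin F a₂ b₂ (lin F a₁ b₁ x)))
        ≤ lin F a₃ b₃ (lin F a₂ b₂ (lin F a₄ b₄ (lin F a₁ b₁ x))))
lemma12 F a₁ b₁ a₂ b₂ a₃ b₃ a₄ b₄ γ₁ γ₂ γ₃ γ₄ _ _ 0≤a₃ 0≤a₄ 1≤a₁ 1≤a₃ a₂<1 a₄<1 γ-f₁ γ-f₂ γ-f₃ γ-f₄ γ₂≤γ₁ γ₃≤γ₂ γ₄≤γ₃ x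
  with LinearMaps.contracting-γ-finite F a₂<1 γ-f₂
... | p , p≤γ₂ , γ₂≤p =
  four-map-inequality p 0≤a₃ 0≤a₄ 1≤a₁ (proj₁ a₄<1)
    (expanding-pulls-down 1≤a₁ γ-f₁ (≤ₑ-trans p≤γ₂ γ₂≤γ₁))
    (contracting-pushes-up a₂<1 γ-f₂ p≤γ₂)
    (expanding-pushes-up 1≤a₃ γ-f₃ (≤ₑ-trans γ₃≤γ₂ γ₂≤p))
    (contracting-pulls-down a₄<1 γ-f₄ (≤ₑ-trans γ₄≤γ₃ (≤ₑ-trans γ₃≤γ₂ γ₂≤p)))
    x
  where open LinearMaps F
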